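{- Let $a^{(1)},\ldots,a^{(m)}$ be the rows of an integral matrix $A\in\mathbb{Z}^{m\times n}$. For a permutation $\pi$ of $\{1,\ldots,m\}$ define $d^{(\pi)}_1=\lVert a^{(\pi(1))}\rVert_1$ and, for $i=1,\ldots,m-1$, \[ d^{(\pi)}_{i+1}=\Big\lceil \min_{\lambda_1,\ldots,\lambda_i\in\mathbb{R}}\big\lVert a^{(\pi(i+1))}-\textstyle\sum_{k=1}^{i}\lambda_k a^{(\pi(k))}\big\rVert_1\Big\rceil. \] Then $|A\cdot\{0,1\}^n|\le\min_\pi\prod_{i=1}^m(d^{(\pi)}_i+1)$, where $A\cdot\{0,1\}^n=\{Ax: x\in\{0,1\}^n\}$.
   Formalization: The coefficients $\lambda_1,\ldots,\lambda_i$ in the minimum defining $d^{(\pi)}_{i+1}$ range over ℚ rather than ℝ. -}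

module Defs where

open import Data.Bool using (Bool; true; false; if_then_else_)
open import Data.Nat as ℕ using (ℕ; zero; suc; _<ᵇ_)
open import Data.Integer as ℤ using (ℤ)
open import Data.Rational as ℚ using (ℚ; 0ℚ)
open import Data.Fin using (Fin; zero; suc; toℕ)
open import Data.Fin.Permutation using (Permutation′; _⟨$⟩ʳ_)
open import Data.Vec using (Vec; tabulate)
open import Data.Vec.Properties using (≡-dec)
open import Data.List using (List; []; _∷_; map; length; deduplicate; concatMap)
open import Data.Product using (∃; _×_)

Matrix : ℕ → ℕ → Set
Matrix m n = Fin m → Fin n → ℤ

sumℚ : ∀ {n} → (Fin n → ℚ) → ℚ
sumℚ {zero}  f = 0ℚ
sumℚ {suc n} f = f zero ℚ.+ sumℚ (λ i → f (suc i))

sumℤ : ∀ {n} → (Fin n → ℤ) → ℤ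
sumℤ {zero}  f = ℤ.0ℤ
sumℤ {suc n} f = f zero ℤ.+ sumℤ (λ i → f (suc i))

prodℕ : ∀ {n} → (Fin n → ℕ) → ℕ
prodℕ {zero}  f = 1
prodℕ {suc n} f = f zero ℕ.* prodℕ (λ i → f (suc i))

norm₁ : ∀ {n} → (Fin n → ℚ) → ℚ
norm₁ v = sumℚ (λ c → ℚ.∣ v c ∣)

toℚ : ℤ → ℚ
toℚ z = z ℚ./ 1

-- The vector  a^{(π(j))} − Σ_{k<j} λ_k a^{(π(k))}  (indices 0-based; only λ_k
-- with k < j are used).
residual : ∀ {m n} → Matrix m n → Permutation′ m → Fin m → (Fin m → ℚ) → Fin n → ℚ
residual A π j lam c =
  toℚ (A (π ⟨$⟩ʳ j) c) ℚ.-
  sumℚ (λ k → if toℕ k <ᵇ toℕ j then lam k ℚ.* toℚ (A (π ⟨$⟩ʳ k) c) else 0ℚ)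

Achieves : ∀ {m n} → Matrix m n → Permutation′ m → Fin m → ℕ → Set
Achieves {m} A π j D = ∃ λ (lam : Fin m → ℚ) → norm₁ (residual A π j lam) ℚ.≤ (ℤ.+ D) ℚ./ 1

-- d^{(π)}_{j+1} = ⌈ min_λ ‖a^{(π(j))} − Σ_{k<j} λ_k a^{(π(k))}‖₁ ⌉ :
-- D is the least natural number achieved.  (For j = 0 this is ‖a^{(π(0))}‖₁.)
IsD : ∀ {m n} → Matrix m n → Permutation′ m → Fin m → ℕ → Set
IsD A π j D = Achieves A π j D × (∀ D′ → Achieves A π j D′ → D ℕ.≤ D′)

allBits : (n : ℕ) → List (Fin n → ℤ)
allBits zero    = (λ ()) ∷ []
allBits (suc n) = concatMap (λ x → (λ { zero → ℤ.0ℤ ; (suc i) → x i })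
                                 ∷ (λ { zero → ℤ.1ℤ ; (suc i) → x i }) ∷ [])
                            (allBits n)

mulVec : ∀ {m n} → Matrix m n → (Fin n → ℤ) → Vec ℤ m
mulVec A x = tabulate (λ r → sumℤ (λ c → A r c ℤ.* x c))

imageSize : ∀ {m n} → Matrix m n → ℕ
imageSize {n = n} A = length (deduplicate (≡-dec ℤ._≟_) (map (mulVec A) (allBits n)))

{-# OPTIONS --safe #-}

-- Write F x k for the π(k)-th entry of A x. If x, y ∈ {0,1}ⁿ have F x k = F y k for all k < j,
-- then x − y is orthogonal to the rows a^(π(k)), k < j, so for every λ the entry difference
-- F x j − F y j = a^(π(j))·(x − y) equals r·(x − y) with r = a^(π(j)) − Σ_{k<j} λ_k a^(π(k)).
-- Since x − y ∈ {−1,0,1}ⁿ, this is at most ‖r‖₁ ≤ d_j in absolute value. Hence within each class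
-- of points agreeing below j, the j-th entry exceeds its least value in the class by at most d_j,
-- and these offsets form a code in ∏_j {0,…,d_j} that determines A x.
module Submission where

open import Defs
open import Data.Nat using (ℕ; suc; _≤_)
open import Data.Fin using (Fin)
open import Data.Fin.Permutation using (Permutation′)

open import Algebra.Bundles using (CommutativeMonoid)
open import Data.Bool using (T; true; false; if_then_else_)
open import Data.Empty using (⊥-elim)
open import Data.Unit using (tt)
open import Data.Nat as ℕ using (zero; _<ᵇ_)
import Data.Nat.Properties as ℕP
open import Data.Nat.DivMod using (_mod_; m%n<n; m<n⇒m%n≡m)
open import Data.Integer as ℤ using (ℤ; +_; -[1+_]; 0ℤ; 1ℤ)
import Data.Integer.Properties as ℤP
open import Data.Rational as ℚ using (ℚ; 0ℚ; 1ℚ)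
open import Data.Rational.Literals using (fromℤ)
import Data.Rational.Properties as ℚP
open import Data.Fin as Fin using (zero; suc; toℕ; combine)
import Data.Fin.Properties as FinP
open import Data.Fin.Induction using (<-wellFounded)
open import Data.Fin.Permutation using (_⟨$⟩ʳ_; _⟨$⟩ˡ_; inverseʳ)
open import Data.Vec.Properties using (≡-dec; tabulate-cong)
open import Data.List using (List; []; _∷_; map; length; deduplicate; filter; lookup)
open import Data.List.Membership.Propositional using (_∈_)
open import Data.List.Membership.Propositional.Properties
  using (∈-map⁻; ∈-deduplicate⁻; ∈-lookup; ∈-filter⁺; ∈-filter⁻)
open import Data.List.Relation.Unary.All as All using (All; []; _∷_)
open import Data.List.Relation.Unary.All.Properties using (concat⁺; map⁺)
open import Data.List.Relation.Unary.AllPairs using (_∷_)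
open import Data.List.Relation.Unary.Unique.Propositional using (Unique)
open import Data.List.Relation.Unary.Unique.DecPropositional.Properties using (deduplicate-!)
open import Data.Product using (∃; _×_; _,_; proj₁; proj₂)
open import Data.Sum using (_⊎_; inj₁; inj₂)
open import Induction.WellFounded using (Acc; acc)
open import Relation.Binary.Definitions using (DecidableEquality)
open import Relation.Nullary using (Dec)
open import Relation.Nullary.Decidable using (_→-dec_)
open import Relation.Binary.PropositionalEquality

open import Algebra.Properties.AbelianGroup ℤP.+-0-abelianGroup using (∙-cancelʳ)
open import Algebra.Properties.CommutativeSemigroup
  (CommutativeMonoid.commutativeSemigroup ℚP.+-0-commutativeMonoid)
  using () renaming (interchange to +-interchange)
open import Data.List.Extrema ℤP.≤-totalOrder using (argmin; argmin-all; f[argmin]≤f[xs])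

-- ℚ's operations compute on fromℤ i, whereas toℚ i = i / 1 still has to be normalised.
toℚ≡fromℤ : ∀ i → toℚ i ≡ fromℤ i
toℚ≡fromℤ i = ℚP.↥p/↧p≡p (fromℤ i)

toℚ-+ : ∀ i j → toℚ (i ℤ.+ j) ≡ toℚ i ℚ.+ toℚ j
toℚ-+ i j = begin
  toℚ (i ℤ.+ j)        ≡⟨ ℚP./-cong (sym (cong₂ ℤ._+_ (ℤP.*-identityʳ i) (ℤP.*-identityʳ j))) refl ⟩
  fromℤ i ℚ.+ fromℤ j  ≡⟨ sym (cong₂ ℚ._+_ (toℚ≡fromℤ i) (toℚ≡fromℤ j)) ⟩
  toℚ i ℚ.+ toℚ j      ∎
  where open ≡-Reasoning

toℚ-* : ∀ i j → toℚ (i ℤ.* j) ≡ toℚ i ℚ.* toℚ j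
toℚ-* i j = sym (cong₂ ℚ._*_ (toℚ≡fromℤ i) (toℚ≡fromℤ j))

fromℤ-neg : ∀ i → fromℤ (ℤ.- i) ≡ ℚ.- fromℤ i
fromℤ-neg (+ zero)  = refl
fromℤ-neg (+ suc _) = refl
fromℤ-neg -[1+ _ ]  = refl

toℚ-neg : ∀ i → toℚ (ℤ.- i) ≡ ℚ.- toℚ i
toℚ-neg i = trans (toℚ≡fromℤ (ℤ.- i)) (trans (fromℤ-neg i) (cong ℚ.-_ (sym (toℚ≡fromℤ i))))

toℚ-minus : ∀ i j → toℚ (i ℤ.- j) ≡ toℚ i ℚ.- toℚ j
toℚ-minus i j = trans (toℚ-+ i (ℤ.- j)) (cong (toℚ i ℚ.+_) (toℚ-neg j))

toℚ-sumℤ : ∀ {n} (f : Fin n → ℤ) → toℚ (sumℤ f) ≡ sumℚ (λ c → toℚ (f c))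
toℚ-sumℤ {zero}  f = refl
toℚ-sumℤ {suc n} f = trans (toℚ-+ (f zero) (sumℤ (λ c → f (suc c))))
                           (cong (toℚ (f zero) ℚ.+_) (toℚ-sumℤ (λ c → f (suc c))))

∣toℚ∣≤toℚ⇒∣∣≤ : ∀ i d → ℚ.∣ toℚ i ∣ ℚ.≤ toℚ (+ d) → ℤ.∣ i ∣ ≤ d
∣toℚ∣≤toℚ⇒∣∣≤ i d ∣i∣≤d rewrite toℚ≡fromℤ i | toℚ≡fromℤ (+ d) =
  ℤP.drop‿+≤+ (subst₂ ℤ._≤_ (ℤP.*-identityʳ (+ ℤ.∣ i ∣)) (ℤP.*-identityʳ (+ d)) (ℚP.drop-*≤* ∣i∣≤d))

sumℚ-cong : ∀ {n} {f g : Fin n → ℚ} → (∀ c → f c ≡ g c) → sumℚ f ≡ sumℚ g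
sumℚ-cong {zero}  f≗g = refl
sumℚ-cong {suc n} f≗g = cong₂ ℚ._+_ (f≗g zero) (sumℚ-cong (λ c → f≗g (suc c)))

sumℚ-zero : ∀ n → sumℚ {n} (λ _ → 0ℚ) ≡ 0ℚ
sumℚ-zero zero    = refl
sumℚ-zero (suc n) = trans (ℚP.+-identityˡ _) (sumℚ-zero n)

sumℚ-distrib-+ : ∀ {n} (f g : Fin n → ℚ) → sumℚ (λ c → f c ℚ.+ g c) ≡ sumℚ f ℚ.+ sumℚ g
sumℚ-distrib-+ {zero}  f g = refl
sumℚ-distrib-+ {suc n} f g =
  trans (cong ((f zero ℚ.+ g zero) ℚ.+_) (sumℚ-distrib-+ (λ c → f (suc c)) (λ c → g (suc c))))
        (+-interchange (f zero) (g zero) (sumℚ (λ c → f (suc c))) (sumℚ (λ c → g (suc c))))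

sumℚ-neg : ∀ {n} (f : Fin n → ℚ) → sumℚ (λ c → ℚ.- f c) ≡ ℚ.- sumℚ f
sumℚ-neg {zero}  f = refl
sumℚ-neg {suc n} f = trans (cong (ℚ.- f zero ℚ.+_) (sumℚ-neg (λ c → f (suc c))))
                           (sym (ℚP.neg-distrib-+ (f zero) (sumℚ (λ c → f (suc c)))))

sumℚ-distrib-minus : ∀ {n} (f g : Fin n → ℚ) → sumℚ (λ c → f c ℚ.- g c) ≡ sumℚ f ℚ.- sumℚ g
sumℚ-distrib-minus f g = trans (sumℚ-distrib-+ f (λ c → ℚ.- g c)) (cong (sumℚ f ℚ.+_) (sumℚ-neg g))

*-distribˡ-sumℚ : ∀ {n} q (f : Fin n → ℚ) → q ℚ.* sumℚ f ≡ sumℚ (λ c → q ℚ.* f c)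
*-distribˡ-sumℚ {zero}  q f = ℚP.*-zeroʳ q
*-distribˡ-sumℚ {suc n} q f = trans (ℚP.*-distribˡ-+ q (f zero) _)
                                    (cong (q ℚ.* f zero ℚ.+_) (*-distribˡ-sumℚ q (λ c → f (suc c))))

*-distribʳ-sumℚ : ∀ {n} q (f : Fin n → ℚ) → sumℚ f ℚ.* q ≡ sumℚ (λ c → f c ℚ.* q)
*-distribʳ-sumℚ {zero}  q f = ℚP.*-zeroˡ q
*-distribʳ-sumℚ {suc n} q f = trans (ℚP.*-distribʳ-+ q (f zero) _)
                                    (cong (f zero ℚ.* q ℚ.+_) (*-distribʳ-sumℚ q (λ c → f (suc c))))

sumℚ-comm : ∀ {m n} (f : Fin m → Fin n → ℚ) →
            sumℚ (λ i → sumℚ (λ j → f i j)) ≡ sumℚ (λ j → sumℚ (λ i → f i j))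
sumℚ-comm {zero}  {n} f = sym (sumℚ-zero n)
sumℚ-comm {suc m} f = trans (cong (sumℚ (f zero) ℚ.+_) (sumℚ-comm (λ i → f (suc i))))
                            (sym (sumℚ-distrib-+ (f zero) (λ j → sumℚ (λ i → f (suc i) j))))

infix 7 _∙_

_∙_ : ∀ {n} → (Fin n → ℚ) → (Fin n → ℚ) → ℚ
u ∙ v = sumℚ (λ c → u c ℚ.* v c)

∙-distribʳ-minus : ∀ {n} (u v z : Fin n → ℚ) → (λ c → u c ℚ.- v c) ∙ z ≡ u ∙ z ℚ.- v ∙ z
∙-distribʳ-minus u v z = trans (sumℚ-cong distrib) (sumℚ-distrib-minus (λ c → u c ℚ.* z c) (λ c → v c ℚ.* z c))
  where
  distrib : ∀ c → (u c ℚ.- v c) ℚ.* z c ≡ u c ℚ.* z c ℚ.- v c ℚ.* z c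
  distrib c = trans (ℚP.*-distribʳ-+ (z c) (u c) (ℚ.- v c))
                    (cong (u c ℚ.* z c ℚ.+_) (sym (ℚP.neg-distribˡ-* (v c) (z c))))

∙-distribˡ-minus : ∀ {n} (u v w : Fin n → ℚ) → u ∙ (λ c → v c ℚ.- w c) ≡ u ∙ v ℚ.- u ∙ w
∙-distribˡ-minus u v w = trans (sumℚ-cong distrib) (sumℚ-distrib-minus (λ c → u c ℚ.* v c) (λ c → u c ℚ.* w c))
  where
  distrib : ∀ c → u c ℚ.* (v c ℚ.- w c) ≡ u c ℚ.* v c ℚ.- u c ℚ.* w c
  distrib c = trans (ℚP.*-distribˡ-+ (u c) (v c) (ℚ.- w c))
                    (cong (u c ℚ.* v c ℚ.+_) (sym (ℚP.neg-distribʳ-* (u c) (w c))))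

∙-distribʳ-sum : ∀ {m n} (g : Fin m → Fin n → ℚ) (z : Fin n → ℚ) →
                 (λ c → sumℚ (λ k → g k c)) ∙ z ≡ sumℚ (λ k → g k ∙ z)
∙-distribʳ-sum g z = trans (sumℚ-cong (λ c → *-distribʳ-sumℚ (z c) (λ k → g k c)))
                           (sumℚ-comm (λ c k → g k c ℚ.* z c))

∙-assocˡ : ∀ {n} q (u z : Fin n → ℚ) → (λ c → q ℚ.* u c) ∙ z ≡ q ℚ.* (u ∙ z)
∙-assocˡ q u z = trans (sumℚ-cong (λ c → ℚP.*-assoc q (u c) (z c)))
                       (sym (*-distribˡ-sumℚ q (λ c → u c ℚ.* z c)))

∙-zeroˡ : ∀ {n} (z : Fin n → ℚ) → (λ _ → 0ℚ) ∙ z ≡ 0ℚ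
∙-zeroˡ {n} z = trans (sumℚ-cong (λ c → ℚP.*-zeroˡ (z c))) (sumℚ-zero n)

∙-if-zero : ∀ {n} b (u z : Fin n → ℚ) → (T b → u ∙ z ≡ 0ℚ) → (λ c → if b then u c else 0ℚ) ∙ z ≡ 0ℚ
∙-if-zero true  u z u⊥z = u⊥z tt
∙-if-zero false u z _   = ∙-zeroˡ z

∣∙∣≤norm₁ : ∀ {n} (r z : Fin n → ℚ) → (∀ c → ℚ.∣ z c ∣ ℚ.≤ 1ℚ) → ℚ.∣ r ∙ z ∣ ℚ.≤ norm₁ r
∣∙∣≤norm₁ {zero}  r z ∣z∣≤1 = ℚP.≤-refl
∣∙∣≤norm₁ {suc n} r z ∣z∣≤1 = ℚP.≤-trans
  (ℚP.∣p+q∣≤∣p∣+∣q∣ (r zero ℚ.* z zero) ((λ c → r (suc c)) ∙ (λ c → z (suc c))))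
  (ℚP.+-mono-≤ head-bound (∣∙∣≤norm₁ (λ c → r (suc c)) (λ c → z (suc c)) (λ c → ∣z∣≤1 (suc c))))
  where
  head-bound : ℚ.∣ r zero ℚ.* z zero ∣ ℚ.≤ ℚ.∣ r zero ∣
  head-bound = begin
    ℚ.∣ r zero ℚ.* z zero ∣          ≡⟨ ℚP.∣p*q∣≡∣p∣*∣q∣ (r zero) (z zero) ⟩
    ℚ.∣ r zero ∣ ℚ.* ℚ.∣ z zero ∣    ≤⟨ ℚP.*-monoˡ-≤-nonNeg ℚ.∣ r zero ∣ {{ℚP.∣-∣-nonNeg (r zero)}} (∣z∣≤1 zero) ⟩
    ℚ.∣ r zero ∣ ℚ.* 1ℚ              ≡⟨ ℚP.*-identityʳ ℚ.∣ r zero ∣ ⟩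
    ℚ.∣ r zero ∣                     ∎
    where open ℚP.≤-Reasoning

permutedMulVec : ∀ {m n} → Matrix m n → Permutation′ m → (Fin n → ℤ) → Fin m → ℤ
permutedMulVec A π x k = sumℤ (λ c → A (π ⟨$⟩ʳ k) c ℤ.* x c)

mulVec-cong : ∀ {m n} (A : Matrix m n) (π : Permutation′ m) {x y : Fin n → ℤ} →
              (∀ k → permutedMulVec A π x k ≡ permutedMulVec A π y k) → mulVec A x ≡ mulVec A y
mulVec-cong A π {x} {y} eq = tabulate-cong λ r →
  subst (λ r′ → sumℤ (λ c → A r′ c ℤ.* x c) ≡ sumℤ (λ c → A r′ c ℤ.* y c)) (inverseʳ π) (eq (π ⟨$⟩ˡ r))

Bit : ℤ → Set
Bit v = v ≡ 0ℤ ⊎ v ≡ 1ℤ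

allBits-bits : ∀ n → All (λ x → ∀ c → Bit (x c)) (allBits n)
allBits-bits zero    = (λ ()) ∷ []
allBits-bits (suc n) = concat⁺ (map⁺ (All.map
  (λ bits → (λ { zero → inj₁ refl ; (suc c) → bits c }) ∷ (λ { zero → inj₂ refl ; (suc c) → bits c }) ∷ [])
  (allBits-bits n)))

∣bit-bit∣≤1 : ∀ {u v} → Bit u → Bit v → ℚ.∣ toℚ u ℚ.- toℚ v ∣ ℚ.≤ 1ℚ
∣bit-bit∣≤1 (inj₁ refl) (inj₁ refl) = ℚP.≤ᵇ⇒≤ tt
∣bit-bit∣≤1 (inj₁ refl) (inj₂ refl) = ℚP.≤ᵇ⇒≤ tt
∣bit-bit∣≤1 (inj₂ refl) (inj₁ refl) = ℚP.≤ᵇ⇒≤ tt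
∣bit-bit∣≤1 (inj₂ refl) (inj₂ refl) = ℚP.≤ᵇ⇒≤ tt

module _ {m n} (A : Matrix m n) (π : Permutation′ m) where

  row : Fin m → Fin n → ℚ
  row k c = toℚ (A (π ⟨$⟩ʳ k) c)

  toℚ-permutedMulVec : ∀ x k → toℚ (permutedMulVec A π x k) ≡ row k ∙ (λ c → toℚ (x c))
  toℚ-permutedMulVec x k = trans (toℚ-sumℤ (λ c → A (π ⟨$⟩ʳ k) c ℤ.* x c))
                                 (sumℚ-cong (λ c → toℚ-* (A (π ⟨$⟩ʳ k) c) (x c)))

  residual∙≡row∙ : ∀ j lam (z : Fin n → ℚ) → (∀ k → k Fin.< j → row k ∙ z ≡ 0ℚ) →
                   residual A π j lam ∙ z ≡ row j ∙ z
  residual∙≡row∙ j lam z z⊥earlier = begin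
    residual A π j lam ∙ z
      ≡⟨ ∙-distribʳ-minus (row j) (λ c → sumℚ (λ k → term k c)) z ⟩
    row j ∙ z ℚ.- (λ c → sumℚ (λ k → term k c)) ∙ z
      ≡⟨ cong (λ t → row j ∙ z ℚ.- t) (trans (∙-distribʳ-sum term z) (sumℚ-cong term∙z≡0)) ⟩
    row j ∙ z ℚ.- sumℚ {m} (λ _ → 0ℚ)
      ≡⟨ cong (λ t → row j ∙ z ℚ.- t) (sumℚ-zero m) ⟩
    row j ∙ z ℚ.+ 0ℚ
      ≡⟨ ℚP.+-identityʳ (row j ∙ z) ⟩
    row j ∙ z ∎
    where
    open ≡-Reasoning
    term : Fin m → Fin n → ℚ
    term k c = if toℕ k <ᵇ toℕ j then lam k ℚ.* row k c else 0ℚ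
    term∙z≡0 : ∀ k → term k ∙ z ≡ 0ℚ
    term∙z≡0 k = ∙-if-zero (toℕ k <ᵇ toℕ j) (λ c → lam k ℚ.* row k c) z λ k<ᵇj → begin
      (λ c → lam k ℚ.* row k c) ∙ z ≡⟨ ∙-assocˡ (lam k) (row k) z ⟩
      lam k ℚ.* (row k ∙ z)         ≡⟨ cong (lam k ℚ.*_) (z⊥earlier k (ℕP.<ᵇ⇒< _ _ k<ᵇj)) ⟩
      lam k ℚ.* 0ℚ                  ≡⟨ ℚP.*-zeroʳ (lam k) ⟩
      0ℚ                            ∎

  residual-spread : ∀ j lam D {x y} → (∀ c → Bit (x c)) → (∀ c → Bit (y c)) →
                    (∀ k → k Fin.< j → permutedMulVec A π x k ≡ permutedMulVec A π y k) →
                    norm₁ (residual A π j lam) ℚ.≤ toℚ (+ D) →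
                    ℤ.∣ permutedMulVec A π x j ℤ.- permutedMulVec A π y j ∣ ≤ D
  residual-spread j lam D {x} {y} x-bits y-bits agree ‖residual‖≤D =
    ∣toℚ∣≤toℚ⇒∣∣≤ (Ax j ℤ.- Ay j) D (begin
      ℚ.∣ toℚ (Ax j ℤ.- Ay j) ∣     ≡⟨ cong ℚ.∣_∣ (trans (toℚ-diff j) (sym (residual∙≡row∙ j lam z z⊥earlier))) ⟩
      ℚ.∣ residual A π j lam ∙ z ∣  ≤⟨ ∣∙∣≤norm₁ (residual A π j lam) z (λ c → ∣bit-bit∣≤1 (x-bits c) (y-bits c)) ⟩
      norm₁ (residual A π j lam)    ≤⟨ ‖residual‖≤D ⟩
      toℚ (+ D)                     ∎)
    where
    open ℚP.≤-Reasoning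
    Ax Ay : Fin m → ℤ
    Ax = permutedMulVec A π x
    Ay = permutedMulVec A π y
    z : Fin n → ℚ
    z c = toℚ (x c) ℚ.- toℚ (y c)
    toℚ-diff : ∀ k → toℚ (Ax k ℤ.- Ay k) ≡ row k ∙ z
    toℚ-diff k = trans (toℚ-minus (Ax k) (Ay k))
      (trans (cong₂ ℚ._-_ (toℚ-permutedMulVec x k) (toℚ-permutedMulVec y k))
             (sym (∙-distribˡ-minus (row k) (λ c → toℚ (x c)) (λ c → toℚ (y c)))))
    z⊥earlier : ∀ k → k Fin.< j → row k ∙ z ≡ 0ℚ
    z⊥earlier k k<j = trans (sym (toℚ-diff k))
      (cong toℚ (trans (cong (ℤ._- Ay k) (agree k k<j)) (ℤP.+-inverseʳ (Ay k))))

lookup-injective : ∀ {A : Set} {xs : List A} → Unique xs → ∀ {i j} → lookup xs i ≡ lookup xs j → i ≡ j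
lookup-injective {xs = _ ∷ _}  (_ ∷ _)      {zero}  {zero}  _ = refl
lookup-injective {xs = _ ∷ xs} (x∉xs ∷ _)   {zero}  {suc j} e =
  ⊥-elim (All.lookup x∉xs (∈-lookup {xs = xs} j) e)
lookup-injective {xs = _ ∷ xs} (x∉xs ∷ _)   {suc i} {zero}  e =
  ⊥-elim (All.lookup x∉xs (∈-lookup {xs = xs} i) (sym e))
lookup-injective {xs = _ ∷ _}  (_ ∷ unique) {suc i} {suc j} e = cong suc (lookup-injective unique e)

length-deduplicate-map≤ : ∀ {X V : Set} (_≟_ : DecidableEquality V) (g : X → V) (B : List X) {N}
                          (h : X → Fin N) → (∀ {x y} → x ∈ B → y ∈ B → h x ≡ h y → g x ≡ g y) →
                          length (deduplicate _≟_ (map g B)) ≤ N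
length-deduplicate-map≤ {V = V} _≟_ g B h h-determines-g = FinP.injective⇒≤ h∘preimage-injective
  where
  U : List V
  U = deduplicate _≟_ (map g B)
  preimage : (i : Fin (length U)) → ∃ λ x → x ∈ B × lookup U i ≡ g x
  preimage i = ∈-map⁻ g (∈-deduplicate⁻ _≟_ (map g B) (∈-lookup {xs = U} i))
  h∘preimage-injective : ∀ {i j} → h (proj₁ (preimage i)) ≡ h (proj₁ (preimage j)) → i ≡ j
  h∘preimage-injective {i} {j} e with preimage i | preimage j
  ... | x , x∈B , Uᵢ≡gx | y , y∈B , Uⱼ≡gy = lookup-injective (deduplicate-! _≟_ (map g B))
        (trans Uᵢ≡gx (trans (h-determines-g x∈B y∈B e) (sym Uⱼ≡gy)))

combineΠ : ∀ {m} (s : Fin m → ℕ) → ((j : Fin m) → Fin (s j)) → Fin (prodℕ s)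
combineΠ {zero}  s u = zero
combineΠ {suc m} s u = combine (u zero) (combineΠ (λ j → s (suc j)) (λ j → u (suc j)))

combineΠ-injective : ∀ {m} (s : Fin m → ℕ) (u v : (j : Fin m) → Fin (s j)) →
                     combineΠ s u ≡ combineΠ s v → ∀ j → u j ≡ v j
combineΠ-injective {suc m} s u v e zero    = proj₁ (FinP.combine-injective (u zero) _ (v zero) _ e)
combineΠ-injective {suc m} s u v e (suc j) =
  combineΠ-injective (λ j → s (suc j)) (λ j → u (suc j)) (λ j → v (suc j))
    (proj₂ (FinP.combine-injective (u zero) _ (v zero) _ e)) j

toℕ-mod : ∀ {k n} → k ≤ n → toℕ (k mod suc n) ≡ k
toℕ-mod {k} {n} k≤n = trans (FinP.toℕ-fromℕ< (m%n<n k (suc n))) (m<n⇒m%n≡m (ℕ.s≤s k≤n))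

module _ {X : Set} {m : ℕ} (F : X → Fin m → ℤ) where

  AgreeBelow : Fin m → X → X → Set
  AgreeBelow j x y = ∀ k → k Fin.< j → F x k ≡ F y k

  agreeBelow? : ∀ j x y → Dec (AgreeBelow j x y)
  agreeBelow? j x y = FinP.all? (λ k → (k FinP.<? j) →-dec (F x k ℤ.≟ F y k))

  BoundedSpread : List X → (Fin m → ℕ) → Set
  BoundedSpread B d = ∀ j {x y} → x ∈ B → y ∈ B → AgreeBelow j x y → ℤ.∣ F x j ℤ.- F y j ∣ ≤ d j

  module _ (B : List X) where

    pivot : Fin m → X → X
    pivot j x = argmin (λ y → F y j) x (filter (agreeBelow? j x) B)

    pivot-∈ : ∀ j {x} → x ∈ B → pivot j x ∈ B × AgreeBelow j x (pivot j x)
    pivot-∈ j {x} x∈B = argmin-all (λ y → F y j) (x∈B , λ _ _ → refl)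
                                   (All.tabulate (∈-filter⁻ (agreeBelow? j x)))

    pivot-minimal : ∀ j {x y} → y ∈ B → AgreeBelow j x y → F (pivot j x) j ℤ.≤ F y j
    pivot-minimal j {x} y∈B x≈y =
      All.lookup (f[argmin]≤f[xs] {f = λ y → F y j} x (filter (agreeBelow? j x) B))
                 (∈-filter⁺ (agreeBelow? j x) y∈B x≈y)

    pivot-cong : ∀ j {x x′} → x ∈ B → x′ ∈ B → AgreeBelow j x x′ → F (pivot j x) j ≡ F (pivot j x′) j
    pivot-cong j x∈B x′∈B x≈x′ =
      ℤP.≤-antisym (pivot-mono x≈x′ x′∈B) (pivot-mono (λ k k<j → sym (x≈x′ k k<j)) x∈B)
      where
      pivot-mono : ∀ {x x′} → AgreeBelow j x x′ → x′ ∈ B → F (pivot j x) j ℤ.≤ F (pivot j x′) j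
      pivot-mono x≈x′ x′∈B = pivot-minimal j (proj₁ (pivot-∈ j x′∈B))
                               (λ k k<j → trans (x≈x′ k k<j) (proj₂ (pivot-∈ j x′∈B) k k<j))

    offset : Fin m → X → ℕ
    offset j x = ℤ.∣ F x j ℤ.- F (pivot j x) j ∣

    F-pivot≡offset : ∀ j {x} → x ∈ B → F x j ℤ.- F (pivot j x) j ≡ + offset j x
    F-pivot≡offset j x∈B = sym (ℤP.0≤i⇒+∣i∣≡i (ℤP.i≤j⇒0≤j-i (pivot-minimal j x∈B (λ _ _ → refl))))

    module _ (d : Fin m → ℕ) (spread≤d : BoundedSpread B d) where

      offset≤ : ∀ j {x} → x ∈ B → offset j x ≤ d j
      offset≤ j x∈B = spread≤d j x∈B (proj₁ (pivot-∈ j x∈B)) (proj₂ (pivot-∈ j x∈B))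

      -- By offset≤, mod only casts the offsets into Fin (suc (d j)).
      code : X → (j : Fin m) → Fin (suc (d j))
      code x j = offset j x mod suc (d j)

      code-determines : ∀ j {x y} → x ∈ B → y ∈ B → AgreeBelow j x y →
                        code x j ≡ code y j → F x j ≡ F y j
      code-determines j {x} {y} x∈B y∈B x≈y e = ∙-cancelʳ (ℤ.- F (pivot j y) j) (F x j) (F y j) (begin
        F x j ℤ.- F (pivot j y) j  ≡⟨ cong (λ p → F x j ℤ.- p) (sym (pivot-cong j x∈B y∈B x≈y)) ⟩
        F x j ℤ.- F (pivot j x) j  ≡⟨ F-pivot≡offset j x∈B ⟩
        + offset j x               ≡⟨ cong +_ (trans (sym (toℕ-mod (offset≤ j x∈B)))
                                                     (trans (cong toℕ e) (toℕ-mod (offset≤ j y∈B)))) ⟩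
        + offset j y               ≡⟨ sym (F-pivot≡offset j y∈B) ⟩
        F y j ℤ.- F (pivot j y) j  ∎)
        where open ≡-Reasoning

      code-injective : ∀ {x y} → x ∈ B → y ∈ B → (∀ j → code x j ≡ code y j) → ∀ j → F x j ≡ F y j
      code-injective {x} {y} x∈B y∈B e j = go j (<-wellFounded j)
        where
        go : ∀ j → Acc Fin._<_ j → F x j ≡ F y j
        go j (acc rec) = code-determines j x∈B y∈B (λ k k<j → go k (rec k<j)) (e j)

  length-deduplicate-map≤∏ : ∀ {V : Set} (_≟_ : DecidableEquality V) (g : X → V)
                             (B : List X) (d : Fin m → ℕ) → BoundedSpread B d → (∀ {x y} → (∀ j → F x j ≡ F y j) → g x ≡ g y) →
                             length (deduplicate _≟_ (map g B)) ≤ prodℕ (λ j → suc (d j))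
  length-deduplicate-map≤∏ _≟_ g B d spread≤d F-determines-g =
    length-deduplicate-map≤ _≟_ g B (λ x → combineΠ (λ j → suc (d j)) (code B d spread≤d x))
      (λ x∈B y∈B e → F-determines-g (code-injective B d spread≤d x∈B y∈B (combineΠ-injective _ _ _ e)))

lemma21 : ∀ {m n} (A : Matrix m n) (π : Permutation′ m) (d : Fin m → ℕ) → (∀ j → IsD A π j (d j)) → imageSize A ≤ prodℕ (λ j → suc (d j))
lemma21 {n = n} A π d isD =
  length-deduplicate-map≤∏ (permutedMulVec A π) (≡-dec ℤ._≟_) (mulVec A) (allBits n) d spread≤d (mulVec-cong A π)
  where
  spread≤d : BoundedSpread (permutedMulVec A π) (allBits n) d
  spread≤d j x∈B y∈B x≈y = residual-spread A π j (proj₁ (proj₁ (isD j))) (d j)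
    (All.lookup (allBits-bits n) x∈B) (All.lookup (allBits-bits n) y∈B) x≈y (proj₂ (proj₁ (isD j)))
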